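{- For $n\ge1$, the number of inversion sequences $e\in\mathbf{I}_n$ with no index $i$ such that $e_i\le e_{i+1}\ge e_{i+2}$ equals $n$.
   Context: An inversion sequence of length $n$ is an integer sequence $e=e_1\dots e_n$ with $0\le e_i<i$ for all $i$; $\mathbf{I}_n$ is the set of these. (In the paper's notation this is $|\mathbf{I}_n(\underline{\leq,\geq})|=n$.) -}

module Defs where

open import Data.Nat using (ℕ; zero; suc; _≤_; _≥_; _<_)
open import Data.Fin using (Fin; toℕ)
open import Data.Vec using (Vec; []; lookup)
import Data.Vec as V
open import Data.Product using (Σ; _×_)
open import Relation.Nullary using (¬_)

-- Inversion sequences of length n, built by appending on the right:
-- a sequence of length suc n is one of length n followed by a last entry
-- e_{n+1} ∈ {0,…,n}, i.e. an element of Fin (suc n).  Thus, 1-indexed,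
-- 0 ≤ e_i < i for every i.
data InvSeq : ℕ → Set where
  []   : InvSeq zero
  _∷ʳ_ : ∀ {n} → InvSeq n → Fin (suc n) → InvSeq (suc n)

toVec : ∀ {n} → InvSeq n → Vec ℕ n
toVec []       = []
toVec (e ∷ʳ x) = toVec e V.∷ʳ toℕ x

-- e contains the pattern  e_i ≤ e_{i+1} ≥ e_{i+2}  at some position
-- (positions 0-indexed here: i, i+1, i+2 all < n).
HasPeakPattern : ∀ {n} → InvSeq n → Set
HasPeakPattern {n} e =
  Σ ℕ λ i → Σ (suc (suc i) < n) λ lt →
    let v = toVec e
        a = lookup v (Data.Fin.fromℕ< {i} (lt' lt))
        b = lookup v (Data.Fin.fromℕ< {suc i} (lt'' lt))
        c = lookup v (Data.Fin.fromℕ< {suc (suc i)} lt)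
    in a ≤ b × b ≥ c
  where
  open import Data.Nat.Properties using (<-trans; n<1+n)
  lt'' : ∀ {i} → suc (suc i) < n → suc i < n
  lt'' {i} p = <-trans (n<1+n (suc i)) p
  lt' : ∀ {i} → suc (suc i) < n → i < n
  lt' {i} p = <-trans (n<1+n i) (lt'' p)

-- Inversion sequences avoiding the pattern (the avoidance proof is
-- irrelevant, so this is exactly the subset of such sequences).
record Avoiding (n : ℕ) : Set where
  constructor _,_
  field
    seq      : InvSeq n
    .avoids  : ¬ HasPeakPattern seq

module Submission where

-- Peak-free inversion sequences of length n+1 are exactly the n+1 "stairs"
--
--     stair n j  =  0, 0, 1, …, m−1, m+1, m+2, …, n      (m = n − j),
--
-- i.e. e_i = i − 2 on an initial segment and e_i = i − 1 (the maximal value)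
-- on the last j positions.
--
-- The key
-- fact (lemma `increasing`) is that a peak-free sequence of length ≥ 3
-- strictly increases at its end: its last two entries always satisfy
-- e_{k−1} ≤ e_k, so avoiding e_{k−1} ≤ e_k ≥ e_{k+1} forces e_k < e_{k+1}.
-- Conversely, appending an entry larger than the last one creates no peak
-- (`extend-peakFree`), so every stair is peak-free.  Since e_k ≤ k − 1, an
-- appended entry must be the maximal value or one less; `decode` reads off
-- the number j of final maximal entries, and `stair-decode` shows that every
-- peak-free sequence is the stair it decodes to.

open import Defs
open import Data.Nat using (ℕ; zero; suc; _+_; _≤_; _<_; _≥_; z≤n; s≤s; s≤s⁻¹; _≟_; _<?_)
open import Data.Nat.Properties
  using (≤-refl; ≤-trans; <⇒≤; ≤-antisym; <-trans; ≤∧≢⇒<; <⇒≱; ≮⇒≥; m<n⇒m<1+n; n<1+n; m≤n⇒m<n∨m≡n)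
open import Data.Fin using (Fin; toℕ; fromℕ; fromℕ<; inject₁) renaming (zero to fz; suc to fs)
open import Data.Fin.Properties using (toℕ-fromℕ; toℕ-inject₁; toℕ-inject₁-≢; toℕ-injective; toℕ<n)
open import Data.Vec using (Vec; []; _∷_; lookup)
import Data.Vec as V
open import Data.Product using (_×_; _,_)
open import Data.Sum using (inj₁; inj₂)
open import Data.Empty using (⊥-elim; ⊥-elim-irr)
open import Relation.Binary.PropositionalEquality using (_≡_; _≢_; refl; sym; trans; cong; cong₂; subst; subst₂)
open import Relation.Nullary using (¬_; yes; no)
open import Function.Bundles using (_↔_; mk↔ₛ′)

-- Entry i of a vector of naturals, with default 0 outside the range; this
-- lets positions be plain natural numbers instead of bounded indices.
_!_ : ∀ {n} → Vec ℕ n → ℕ → ℕ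
[]      ! _     = 0
(x ∷ v) ! zero  = x
(x ∷ v) ! suc i = v ! i

lookup-fromℕ< : ∀ {n} (v : Vec ℕ n) i .(i<n : i < n) → lookup v (fromℕ< i<n) ≡ v ! i
lookup-fromℕ< (x ∷ v) zero    _   = refl
lookup-fromℕ< (x ∷ v) (suc i) i<n = lookup-fromℕ< v i (s≤s⁻¹ i<n)

!-∷ʳ-< : ∀ {n} (v : Vec ℕ n) y {i} → i < n → (v V.∷ʳ y) ! i ≡ v ! i
!-∷ʳ-< (x ∷ v) y {zero}  _         = refl
!-∷ʳ-< (x ∷ v) y {suc i} (s≤s i<n) = !-∷ʳ-< v y i<n

!-∷ʳ-end : ∀ {n} (v : Vec ℕ n) y → (v V.∷ʳ y) ! n ≡ y
!-∷ʳ-end []      y = refl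
!-∷ʳ-end (x ∷ v) y = !-∷ʳ-end v y

entry : ∀ {n} → InvSeq n → ℕ → ℕ
entry e i = toVec e ! i

entry-∷ʳ : ∀ {n} (e : InvSeq n) (x : Fin (suc n)) {i} → i < n → entry (e ∷ʳ x) i ≡ entry e i
entry-∷ʳ e x = !-∷ʳ-< (toVec e) (toℕ x)

last : ∀ {n} → InvSeq (suc n) → ℕ
last (e ∷ʳ x) = toℕ x

entry-last : ∀ {n} (e : InvSeq (suc n)) → entry e n ≡ last e
entry-last (e ∷ʳ x) = !-∷ʳ-end (toVec e) (toℕ x)

entry-penultimate : ∀ {n} (e : InvSeq (suc n)) (x : Fin (2 + n)) → entry (e ∷ʳ x) n ≡ last e
entry-penultimate e x = trans (entry-∷ʳ e x ≤-refl) (entry-last e)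

last≤ : ∀ {n} (e : InvSeq (suc n)) → last e ≤ n
last≤ (e ∷ʳ x) = s≤s⁻¹ (toℕ<n x)

Peak : ∀ {n} → InvSeq n → ℕ → Set
Peak {n} e i = 2 + i < n × entry e i ≤ entry e (1 + i) × entry e (2 + i) ≤ entry e (1 + i)

PeakFree : ∀ {n} → InvSeq n → Set
PeakFree e = ∀ i → ¬ Peak e i

avoids⇒peakFree : ∀ {n} (e : InvSeq n) → .(¬ HasPeakPattern e) → PeakFree e
avoids⇒peakFree e avoids i (lt , up , down) =
  ⊥-elim-irr (avoids (i , lt , subst₂ _≤_ (sym a) (sym b) up , subst₂ _≤_ (sym c) (sym b) down))
  where
  a = lookup-fromℕ< (toVec e) i _
  b = lookup-fromℕ< (toVec e) (1 + i) _
  c = lookup-fromℕ< (toVec e) (2 + i) _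

peakFree⇒avoids : ∀ {n} (e : InvSeq n) → PeakFree e → ¬ HasPeakPattern e
peakFree⇒avoids e free (i , lt , up , down) =
  free i (lt , subst₂ _≤_ a b up , subst₂ _≤_ c b down)
  where
  a = lookup-fromℕ< (toVec e) i _
  b = lookup-fromℕ< (toVec e) (1 + i) _
  c = lookup-fromℕ< (toVec e) (2 + i) _

module Window {n i} (e : InvSeq n) (x : Fin (suc n)) (lt : 2 + i < n) where
  at₂ : entry (e ∷ʳ x) (2 + i) ≡ entry e (2 + i)
  at₂ = entry-∷ʳ e x lt

  at₁ : entry (e ∷ʳ x) (1 + i) ≡ entry e (1 + i)
  at₁ = entry-∷ʳ e x (<-trans (n<1+n _) lt)

  at₀ : entry (e ∷ʳ x) i ≡ entry e i
  at₀ = entry-∷ʳ e x (<-trans (n<1+n _) (<-trans (n<1+n _) lt))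

peak-∷ʳ : ∀ {n i} (e : InvSeq n) (x : Fin (suc n)) → Peak e i → Peak (e ∷ʳ x) i
peak-∷ʳ e x (lt , up , down) =
  m<n⇒m<1+n lt , subst₂ _≤_ (sym at₀) (sym at₁) up , subst₂ _≤_ (sym at₂) (sym at₁) down
  where open Window e x lt

peak-init : ∀ {n i} (e : InvSeq n) (x : Fin (suc n)) → 2 + i < n → Peak (e ∷ʳ x) i → Peak e i
peak-init e x lt (_ , up , down) = lt , subst₂ _≤_ at₀ at₁ up , subst₂ _≤_ at₂ at₁ down
  where open Window e x lt

peakFree-init : ∀ {n} (e : InvSeq n) (x : Fin (suc n)) → PeakFree (e ∷ʳ x) → PeakFree e
peakFree-init e x free i p = free i (peak-∷ʳ e x p)

short-peakFree : ∀ {n} (e : InvSeq n) → n ≤ 2 → PeakFree e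
short-peakFree e n≤2 i (lt , _) with ≤-trans lt n≤2
... | s≤s (s≤s ())

-- Appending an entry larger than the last one keeps a sequence peak-free:
-- the only new window is the final one, whose last step goes up.
extend-peakFree : ∀ {n} (e : InvSeq (suc n)) (x : Fin (2 + n)) →
                  PeakFree e → last e < toℕ x → PeakFree (e ∷ʳ x)
extend-peakFree e x free rise i peak@(lt , _ , down) with m≤n⇒m<n∨m≡n (s≤s⁻¹ lt)
... | inj₁ inside = free i (peak-init e x inside peak)
... | inj₂ refl   = <⇒≱ rise (subst₂ _≤_ (entry-last (e ∷ʳ x)) (entry-penultimate e x) down)

-- In a peak-free sequence of length ≥ 2 the last step goes (weakly) up, and
-- hence, once the length is ≥ 3, every further entry must go strictly up.
rising-end : ∀ {n} (e : InvSeq (2 + n)) → PeakFree e → entry e n ≤ last e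
increasing : ∀ {n} (e : InvSeq (2 + n)) (x : Fin (3 + n)) → PeakFree (e ∷ʳ x) → last e < toℕ x

rising-end {zero}  (([] ∷ʳ fz) ∷ʳ y) _    = z≤n
rising-end {suc n} (e ∷ʳ y)           free =
  subst (_≤ toℕ y) (sym (entry-penultimate e y)) (<⇒≤ (increasing e y free))

increasing {n} e x free with last e <? toℕ x
... | yes rise = rise
... | no ¬rise = ⊥-elim (free n (≤-refl , up , down))
  where
  up : entry (e ∷ʳ x) n ≤ entry (e ∷ʳ x) (1 + n)
  up = subst₂ _≤_ (sym (entry-∷ʳ e x (<-trans (n<1+n _) (n<1+n _)))) (sym (entry-penultimate e x))
         (rising-end e (peakFree-init e x free))

  down : entry (e ∷ʳ x) (2 + n) ≤ entry (e ∷ʳ x) (1 + n)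
  down = subst₂ _≤_ (sym (entry-last (e ∷ʳ x))) (sym (entry-penultimate e x)) (≮⇒≥ ¬rise)

stair : (n : ℕ) → Fin (suc n) → InvSeq (suc n)
stair zero    _      = [] ∷ʳ fz
stair (suc n) fz     = stair n fz ∷ʳ inject₁ (fromℕ n)
stair (suc n) (fs j) = stair n j ∷ʳ fromℕ (suc n)

toℕ-inject₁-fromℕ : ∀ n → toℕ (inject₁ (fromℕ n)) ≡ n
toℕ-inject₁-fromℕ n = trans (toℕ-inject₁ (fromℕ n)) (toℕ-fromℕ n)

stair-peakFree : ∀ n j → PeakFree (stair n j)
stair-peakFree zero          j      = short-peakFree (stair zero j) (s≤s z≤n)
stair-peakFree (suc zero)    j      = short-peakFree (stair 1 j) ≤-refl
stair-peakFree (suc (suc n)) fz     =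
  extend-peakFree (stair (suc n) fz) _ (stair-peakFree (suc n) fz)
    (subst₂ _<_ (sym (toℕ-inject₁-fromℕ n)) (sym (toℕ-inject₁-fromℕ (suc n))) (n<1+n n))
stair-peakFree (suc (suc n)) (fs j) =
  extend-peakFree (stair (suc n) j) _ (stair-peakFree (suc n) j)
    (subst (last (stair (suc n) j) <_) (sym (toℕ-fromℕ (2 + n))) (s≤s (last≤ (stair (suc n) j))))

decode : ∀ n → InvSeq (suc n) → Fin (suc n)
decode zero    _        = fz
decode (suc n) (e ∷ʳ x) with toℕ x ≟ suc n
... | yes _ = fs (decode n e)
... | no _  = fz

decode-stair : ∀ n j → decode n (stair n j) ≡ j
decode-stair zero    fz     = refl
decode-stair (suc n) fz     with toℕ (inject₁ (fromℕ n)) ≟ suc n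
... | yes max = ⊥-elim (toℕ-inject₁-≢ (fromℕ n) (sym max))
... | no _    = refl
decode-stair (suc n) (fs j) with toℕ (fromℕ (suc n)) ≟ suc n
... | yes _      = cong fs (decode-stair n j)
... | no not-max = ⊥-elim (not-max (toℕ-fromℕ (suc n)))

lower-extension : ∀ n j (x : Fin (2 + n)) → PeakFree (stair n j ∷ʳ x) →
                  toℕ x ≢ suc n → j ≡ fz × toℕ x ≡ n
lower-extension zero    fz fz      _    _       = refl , refl
lower-extension zero    fz (fs fz) _    not-max = ⊥-elim (not-max refl)
lower-extension (suc n) j  x       free not-max = on-stair j (increasing (stair (suc n) j) x free)
  where
  x≤n+1 : toℕ x ≤ suc n
  x≤n+1 = s≤s⁻¹ (≤∧≢⇒< (s≤s⁻¹ (toℕ<n x)) not-max)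

  on-stair : ∀ k → last (stair (suc n) k) < toℕ x → k ≡ fz × toℕ x ≡ suc n
  on-stair fz     rise = refl , ≤-antisym x≤n+1 (subst (_< toℕ x) (toℕ-inject₁-fromℕ n) rise)
  on-stair (fs _) rise = ⊥-elim (<⇒≱ (subst (_< toℕ x) (toℕ-fromℕ (suc n)) rise) x≤n+1)

stair-decode : ∀ n (e : InvSeq (suc n)) → PeakFree e → stair n (decode n e) ≡ e
stair-decode zero    ([] ∷ʳ fz) _    = refl
stair-decode (suc n) (e ∷ʳ x)   free with toℕ x ≟ suc n | stair-decode n e (peakFree-init e x free)
... | yes max    | prefix = cong₂ _∷ʳ_ prefix (toℕ-injective (trans (toℕ-fromℕ (suc n)) (sym max)))
... | no not-max | prefix
  with lower-extension n (decode n e) x (subst (λ s → PeakFree (s ∷ʳ x)) (sym prefix) free) not-max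
...   | j≡fz , x≡n = cong₂ _∷ʳ_ (trans (cong (stair n) (sym j≡fz)) prefix)
                                (toℕ-injective (trans (toℕ-inject₁-fromℕ n) (sym x≡n)))

avoiding-≡ : ∀ {n} {a b : Avoiding n} → Avoiding.seq a ≡ Avoiding.seq b → a ≡ b
avoiding-≡ {a = _ , _} {b = _ , _} refl = refl

proposition4p3 : (n : ℕ) → n ≥ 1 → Avoiding n ↔ Fin n
proposition4p3 (suc n) _ = mk↔ₛ′ to from (decode-stair n) from∘to
  where
  to : Avoiding (suc n) → Fin (suc n)
  to a = decode n (Avoiding.seq a)

  from : Fin (suc n) → Avoiding (suc n)
  from j = stair n j , peakFree⇒avoids (stair n j) (stair-peakFree n j)

  from∘to : ∀ a → from (to a) ≡ a
  from∘to (e , avoids) = avoiding-≡ (stair-decode n e (avoids⇒peakFree e avoids))
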